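{- (a) For $w\in F_2$: $\mathrm{Pal}(w)=1 \iff R_w(ab)=ab \iff R_w(ba)=ba$. (b) The set $\mathrm{Pal}^{ -1}(1)=\{w\in F_2\mid \mathrm{Pal}(w)=1\}$ is a subgroup of $F_2$.
   Context: $F_2$ is the free group on $a,b$. $w\mapsto R_w$ is the group homomorphism $F_2\to\mathrm{Aut}(F_2)$ with $R_a(a)=a$, $R_a(b)=ba$, $R_b(a)=ab$, $R_b(b)=b$. The palindromization map $\mathrm{Pal}:F_2\to F_2$ is defined by $\mathrm{Pal}(w)=b^{ -1}a^{ -1}R_w(ab)$. -}

module Defs where

open import Data.Bool using (Bool; true; false; if_then_else_)
open import Data.List using (List; []; _∷_; _++_; reverse; map; concatMap)
open import Relation.Binary.PropositionalEquality using (_≡_)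

data Letter : Set where
  a a⁻ b b⁻ : Letter

-- Words (not necessarily reduced) representing elements of F₂.
Word : Set
Word = List Letter

invL : Letter → Letter
invL a  = a⁻
invL a⁻ = a
invL b  = b⁻
invL b⁻ = b

invW : Word → Word
invW w = reverse (map invL w)

cancels : Letter → Letter → Bool
cancels a  a⁻ = true
cancels a⁻ a  = true
cancels b  b⁻ = true
cancels b⁻ b  = true
cancels _  _  = false

push : Letter → Word → Word
push x []       = x ∷ []
push x (y ∷ ys) = if cancels x y then ys else x ∷ y ∷ ys

reduce : Word → Word
reduce []      = []
reduce (x ∷ w) = push x (reduce w)

infix 4 _≈_
_≈_ : Word → Word → Set
u ≈ v = reduce u ≡ reduce v

-- images of generators under R_x for a letter x:
-- R_a(a)=a, R_a(b)=ba ; R_b(a)=ab, R_b(b)=b ;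
-- R_{a⁻¹}(a)=a, R_{a⁻¹}(b)=ba⁻¹ ; R_{b⁻¹}(a)=ab⁻¹, R_{b⁻¹}(b)=b.
imgA imgB : Letter → Word
imgA a  = a ∷ []
imgA a⁻ = a ∷ []
imgA b  = a ∷ b ∷ []
imgA b⁻ = a ∷ b⁻ ∷ []
imgB a  = b ∷ a ∷ []
imgB a⁻ = b ∷ a⁻ ∷ []
imgB b  = b ∷ []
imgB b⁻ = b ∷ []

imgGen : Letter → Letter → Word
imgGen x a  = imgA x
imgGen x b  = imgB x
imgGen x a⁻ = invW (imgA x)
imgGen x b⁻ = invW (imgB x)

-- the endomorphism R_x of the free monoid on letters (induces the automorphism on F₂)
applyL : Letter → Word → Word
applyL x v = concatMap (imgGen x) v

R : Word → Word → Word
R []      v = v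
R (x ∷ w) v = applyL x (R w v)

ab : Word
ab = a ∷ b ∷ []

ba : Word
ba = b ∷ a ∷ []

Pal : Word → Word
Pal w = b⁻ ∷ a⁻ ∷ R w ab

one : Word
one = []

module Submission where

-- The heart of
-- the argument is a twisting lemma: if a word t satisfies R_x(t) ≈ t·x for
-- every letter x, then R_w(t) ≈ t·P(w) for one word P(w) depending only on
-- w.  Both ab and ba satisfy the hypothesis, so R_w(ab) ≈ ab and
-- R_w(ba) ≈ ba are each equivalent to P(w) ≈ 1.  Since Pal(w) = b⁻¹a⁻¹R_w(ab)
-- and b⁻¹a⁻¹·ab ≈ 1, Pal(w) ≈ 1 iff R_w(ab) ≈ ab; hence Pal⁻¹(1) is the
-- stabiliser of ab under w ↦ R_w, and stabilisers are subgroups because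
-- w ↦ R_w is a homomorphism into the automorphisms of F₂.

open import Defs
open import Data.Bool using (true; false)
open import Data.List using ([]; _∷_; _++_; foldr; reverse; map; concatMap)
open import Data.List.Properties
  using (concatMap-++; unfold-reverse; ++-assoc; ++-identityʳ; foldr-++;
         reverse-involutive; reverse-map; map-∘; map-cong; map-id)
open import Data.Product using (_×_; _,_)
open import Function using (_∘_)
open import Function.Bundles using (_⇔_; mk⇔; Equivalence)
open import Function.Properties.Equivalence using () renaming (trans to ⇔-trans; sym to ⇔-sym)
open import Relation.Binary.PropositionalEquality

invL-involutive : ∀ x → invL (invL x) ≡ x
invL-involutive a  = refl
invL-involutive a⁻ = refl
invL-involutive b  = refl
invL-involutive b⁻ = refl

cancels-invL : ∀ x → cancels (invL x) x ≡ true
cancels-invL a  = refl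
cancels-invL a⁻ = refl
cancels-invL b  = refl
cancels-invL b⁻ = refl

cancels⇒invL : ∀ x y → cancels x y ≡ true → x ≡ invL y
cancels⇒invL a  a⁻ _  = refl
cancels⇒invL a⁻ a  _  = refl
cancels⇒invL b  b⁻ _  = refl
cancels⇒invL b⁻ b  _  = refl
cancels⇒invL a  a  ()
cancels⇒invL a  b  ()
cancels⇒invL a  b⁻ ()
cancels⇒invL a⁻ a⁻ ()
cancels⇒invL a⁻ b  ()
cancels⇒invL a⁻ b⁻ ()
cancels⇒invL b  a  ()
cancels⇒invL b  a⁻ ()
cancels⇒invL b  b  ()
cancels⇒invL b⁻ a  ()
cancels⇒invL b⁻ a⁻ ()
cancels⇒invL b⁻ b⁻ ()

invW-involutive : ∀ u → invW (invW u) ≡ u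
invW-involutive u = begin
  reverse (map invL (reverse (map invL u)))  ≡⟨ cong reverse (reverse-map invL (map invL u)) ⟩
  reverse (reverse (map invL (map invL u)))  ≡⟨ reverse-involutive (map invL (map invL u)) ⟩
  map invL (map invL u)                      ≡⟨ map-∘ u ⟨
  map (invL ∘ invL) u                        ≡⟨ map-cong invL-involutive u ⟩
  map (λ x → x) u                            ≡⟨ map-id u ⟩
  u                                          ∎
  where open ≡-Reasoning

invW-∷ : ∀ x u → invW (x ∷ u) ≡ invW u ++ invL x ∷ []
invW-∷ x u = unfold-reverse (invL x) (map invL u)

data Reduced : Word → Set where
  []-reduced  : Reduced []
  [_]-reduced : ∀ x → Reduced (x ∷ [])
  ∷-reduced   : ∀ {x y ys} → cancels x y ≡ false → Reduced (y ∷ ys) → Reduced (x ∷ y ∷ ys)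

tail-reduced : ∀ {y ys} → Reduced (y ∷ ys) → Reduced ys
tail-reduced [ _ ]-reduced  = []-reduced
tail-reduced (∷-reduced _ r) = r

push-reduced : ∀ x {r} → Reduced r → Reduced (push x r)
push-reduced x []-reduced = [ x ]-reduced
push-reduced x {y ∷ ys} r with cancels x y in c
... | true  = tail-reduced r
... | false = ∷-reduced c r

reduce-reduced : ∀ w → Reduced (reduce w)
reduce-reduced []      = []-reduced
reduce-reduced (x ∷ w) = push-reduced x (reduce-reduced w)

pushAll : Word → Word → Word
pushAll u s = foldr push s u

pushAll-reduced : ∀ u {s} → Reduced s → Reduced (pushAll u s)
pushAll-reduced []      r = r
pushAll-reduced (x ∷ u) r = push-reduced x (pushAll-reduced u r)

push-cancel : ∀ x y {r} → cancels x y ≡ true → Reduced r → push x (push y r) ≡ r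
push-cancel x y c []-reduced rewrite c = refl
push-cancel x y {z ∷ zs} c r with cancels y z in c′
... | false rewrite c = refl
push-cancel x y {z ∷ []} c r | true
  rewrite cancels⇒invL x y c | cancels⇒invL y z c′ | invL-involutive z = refl
push-cancel x y {z ∷ w ∷ ws} c (∷-reduced zw r) | true
  rewrite cancels⇒invL x y c | cancels⇒invL y z c′ | invL-involutive z | zw = refl

pushAll-push : ∀ x {r s} → Reduced r → Reduced s → pushAll (push x r) s ≡ push x (pushAll r s)
pushAll-push x []-reduced s = refl
pushAll-push x {y ∷ ys} r s with cancels x y in c
... | true  = sym (push-cancel x y c (pushAll-reduced ys s))
... | false = refl

pushAll-reduce : ∀ u {s} → Reduced s → pushAll (reduce u) s ≡ pushAll u s
pushAll-reduce []      s = refl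
pushAll-reduce (x ∷ u) s =
  trans (pushAll-push x (reduce-reduced u) s) (cong (push x) (pushAll-reduce u s))

reduce-++ : ∀ u v → reduce (u ++ v) ≡ pushAll u (reduce v)
reduce-++ []      v = refl
reduce-++ (x ∷ u) v = cong (push x) (reduce-++ u v)

reduce-++-reduce : ∀ u v → reduce (u ++ v) ≡ pushAll (reduce u) (reduce v)
reduce-++-reduce u v = trans (reduce-++ u v) (sym (pushAll-reduce u (reduce-reduced v)))

++-cong : ∀ u u′ v v′ → u ≈ u′ → v ≈ v′ → u ++ v ≈ u′ ++ v′
++-cong u u′ v v′ p q = begin
  reduce (u ++ v)                 ≡⟨ reduce-++-reduce u v ⟩
  pushAll (reduce u) (reduce v)   ≡⟨ cong₂ pushAll p q ⟩
  pushAll (reduce u′) (reduce v′) ≡⟨ reduce-++-reduce u′ v′ ⟨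
  reduce (u′ ++ v′)               ∎
  where open ≡-Reasoning

pushAll-invW : ∀ u {r} → Reduced r → pushAll (invW u) (pushAll u r) ≡ r
pushAll-invW []      r = refl
pushAll-invW (x ∷ u) {r} rr = begin
  pushAll (invW (x ∷ u)) (push x (pushAll u r))           ≡⟨ cong (λ v → pushAll v (push x (pushAll u r))) (invW-∷ x u) ⟩
  pushAll (invW u ++ invL x ∷ []) (push x (pushAll u r))  ≡⟨ foldr-++ push (push x (pushAll u r)) (invW u) (invL x ∷ []) ⟩
  pushAll (invW u) (push (invL x) (push x (pushAll u r))) ≡⟨ cong (pushAll (invW u)) (push-cancel (invL x) x (cancels-invL x) (pushAll-reduced u rr)) ⟩
  pushAll (invW u) (pushAll u r)                          ≡⟨ pushAll-invW u rr ⟩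
  r                                                       ∎
  where open ≡-Reasoning

++-cancelˡ : ∀ u v v′ → u ++ v ≈ u ++ v′ → v ≈ v′
++-cancelˡ u v v′ p = begin
  reduce v                                   ≡⟨ pushAll-invW u (reduce-reduced v) ⟨
  pushAll (invW u) (pushAll u (reduce v))    ≡⟨ cong (pushAll (invW u)) (reduce-++ u v) ⟨
  pushAll (invW u) (reduce (u ++ v))         ≡⟨ cong (pushAll (invW u)) p ⟩
  pushAll (invW u) (reduce (u ++ v′))        ≡⟨ cong (pushAll (invW u)) (reduce-++ u v′) ⟩
  pushAll (invW u) (pushAll u (reduce v′))   ≡⟨ pushAll-invW u (reduce-reduced v′) ⟩
  reduce v′                                  ∎
  where open ≡-Reasoning

-- A letter substitution σ preserving inverses induces an endomorphism of F₂.
InverseCompatible : (Letter → Word) → Set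
InverseCompatible σ = ∀ y → σ (invL y) ≡ invW (σ y)

evalσ : (Letter → Word) → Word → Word
evalσ σ = foldr (λ y → pushAll (σ y)) []

evalσ-reduced : ∀ σ u → Reduced (evalσ σ u)
evalσ-reduced σ []      = []-reduced
evalσ-reduced σ (y ∷ u) = pushAll-reduced (σ y) (evalσ-reduced σ u)

reduce-concatMap : ∀ σ u → reduce (concatMap σ u) ≡ evalσ σ u
reduce-concatMap σ []      = refl
reduce-concatMap σ (y ∷ u) =
  trans (reduce-++ (σ y) (concatMap σ u)) (cong (pushAll (σ y)) (reduce-concatMap σ u))

-- A cancelling pair of letters is sent to a cancelling pair of words.
evalσ-push : ∀ σ → InverseCompatible σ → ∀ y {r} → Reduced r →
             evalσ σ (push y r) ≡ pushAll (σ y) (evalσ σ r)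
evalσ-push σ σ-inv y []-reduced = refl
evalσ-push σ σ-inv y {z ∷ zs} r with cancels y z in c
... | false = refl
... | true rewrite cancels⇒invL y z c | σ-inv z =
  sym (pushAll-invW (σ z) (evalσ-reduced σ zs))

evalσ-reduce : ∀ σ → InverseCompatible σ → ∀ u → evalσ σ (reduce u) ≡ evalσ σ u
evalσ-reduce σ σ-inv []      = refl
evalσ-reduce σ σ-inv (y ∷ u) =
  trans (evalσ-push σ σ-inv y (reduce-reduced u)) (cong (pushAll (σ y)) (evalσ-reduce σ σ-inv u))

concatMap-cong : ∀ (σ : Letter → Word) → InverseCompatible σ →
                 ∀ u u′ → u ≈ u′ → concatMap σ u ≈ concatMap σ u′
concatMap-cong σ σ-inv u u′ p = begin
  reduce (concatMap σ u)    ≡⟨ reduce-concatMap σ u ⟩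
  evalσ σ u                 ≡⟨ evalσ-reduce σ σ-inv u ⟨
  evalσ σ (reduce u)        ≡⟨ cong (evalσ σ) p ⟩
  evalσ σ (reduce u′)       ≡⟨ evalσ-reduce σ σ-inv u′ ⟩
  evalσ σ u′                ≡⟨ reduce-concatMap σ u′ ⟨
  reduce (concatMap σ u′)   ∎
  where open ≡-Reasoning

concatMap-inverse : ∀ (σ τ : Letter → Word) → (∀ z → concatMap τ (σ z) ≈ z ∷ []) →
                    ∀ w → concatMap τ (concatMap σ w) ≈ w
concatMap-inverse σ τ τσ []      = refl
concatMap-inverse σ τ τσ (z ∷ w) = begin
  reduce (concatMap τ (σ z ++ concatMap σ w))              ≡⟨ cong reduce (concatMap-++ τ (σ z) (concatMap σ w)) ⟩
  reduce (concatMap τ (σ z) ++ concatMap τ (concatMap σ w)) ≡⟨ ++-cong (concatMap τ (σ z)) (z ∷ []) (concatMap τ (concatMap σ w)) w (τσ z) (concatMap-inverse σ τ τσ w) ⟩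
  reduce (z ∷ w)                                            ∎
  where open ≡-Reasoning

imgGen-inverse : ∀ x → InverseCompatible (imgGen x)
imgGen-inverse x a  = refl
imgGen-inverse x a⁻ = sym (invW-involutive (imgA x))
imgGen-inverse x b  = refl
imgGen-inverse x b⁻ = sym (invW-involutive (imgB x))

applyL-cong : ∀ x u u′ → u ≈ u′ → applyL x u ≈ applyL x u′
applyL-cong x = concatMap-cong (imgGen x) (imgGen-inverse x)

R-cong : ∀ w u u′ → u ≈ u′ → R w u ≈ R w u′
R-cong []      u u′ p = p
R-cong (x ∷ w) u u′ p = applyL-cong x (R w u) (R w u′) (R-cong w u u′ p)

R-++ : ∀ u v w → R (u ++ v) w ≡ R u (R v w)
R-++ []      v w = refl
R-++ (x ∷ u) v w = cong (applyL x) (R-++ u v w)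

applyL-invL-letter : ∀ x z → applyL (invL x) (imgGen x z) ≈ z ∷ []
applyL-invL-letter a  a  = refl
applyL-invL-letter a  a⁻ = refl
applyL-invL-letter a  b  = refl
applyL-invL-letter a  b⁻ = refl
applyL-invL-letter a⁻ a  = refl
applyL-invL-letter a⁻ a⁻ = refl
applyL-invL-letter a⁻ b  = refl
applyL-invL-letter a⁻ b⁻ = refl
applyL-invL-letter b  a  = refl
applyL-invL-letter b  a⁻ = refl
applyL-invL-letter b  b  = refl
applyL-invL-letter b  b⁻ = refl
applyL-invL-letter b⁻ a  = refl
applyL-invL-letter b⁻ a⁻ = refl
applyL-invL-letter b⁻ b  = refl
applyL-invL-letter b⁻ b⁻ = refl

R-invW : ∀ u v → R (invW u) (R u v) ≈ v
R-invW []      v = refl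
R-invW (x ∷ u) v = begin
  reduce (R (invW (x ∷ u)) (applyL x (R u v)))               ≡⟨ cong (λ t → reduce (R t (applyL x (R u v)))) (invW-∷ x u) ⟩
  reduce (R (invW u ++ invL x ∷ []) (applyL x (R u v)))      ≡⟨ cong reduce (R-++ (invW u) (invL x ∷ []) (applyL x (R u v))) ⟩
  reduce (R (invW u) (applyL (invL x) (applyL x (R u v))))   ≡⟨ R-cong (invW u) (applyL (invL x) (applyL x (R u v))) (R u v)
                                                                  (concatMap-inverse (imgGen x) (imgGen (invL x)) (applyL-invL-letter x) (R u v)) ⟩
  reduce (R (invW u) (R u v))                                ≡⟨ R-invW u v ⟩
  reduce v                                                   ∎
  where open ≡-Reasoning

Twisted : Word → Set
Twisted t = ∀ x → applyL x t ≈ t ++ x ∷ []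

ab-twisted : Twisted ab
ab-twisted a  = refl
ab-twisted a⁻ = refl
ab-twisted b  = refl
ab-twisted b⁻ = refl

ba-twisted : Twisted ba
ba-twisted a  = refl
ba-twisted a⁻ = refl
ba-twisted b  = refl
ba-twisted b⁻ = refl

-- P(x₁x₂⋯xₙ) = x₁·R_{x₁}(P(x₂⋯xₙ)).  By the next lemma R_w(ab) ≈ ab·P(w),
-- so P(w) is a word representing Pal(w).
palWord : Word → Word
palWord []      = []
palWord (x ∷ w) = x ∷ applyL x (palWord w)

R-twisted : ∀ t → Twisted t → ∀ w → R w t ≈ t ++ palWord w
R-twisted t tw []      = cong reduce (sym (++-identityʳ t))
R-twisted t tw (x ∷ w) = begin
  reduce (applyL x (R w t))                          ≡⟨ applyL-cong x (R w t) (t ++ palWord w) (R-twisted t tw w) ⟩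
  reduce (applyL x (t ++ palWord w))                 ≡⟨ cong reduce (concatMap-++ (imgGen x) t (palWord w)) ⟩
  reduce (applyL x t ++ applyL x (palWord w))        ≡⟨ ++-cong (applyL x t) (t ++ x ∷ []) (applyL x (palWord w)) (applyL x (palWord w)) (tw x) refl ⟩
  reduce ((t ++ x ∷ []) ++ applyL x (palWord w))     ≡⟨ cong reduce (++-assoc t (x ∷ []) (applyL x (palWord w))) ⟩
  reduce (t ++ palWord (x ∷ w))                      ∎
  where open ≡-Reasoning

fixes-twisted⇔palWord-trivial : ∀ t → Twisted t → ∀ w → (R w t ≈ t) ⇔ (palWord w ≈ [])
fixes-twisted⇔palWord-trivial t tw w = mk⇔ to from
  where
  open ≡-Reasoning
  t≈t++[] : t ≈ t ++ []
  t≈t++[] = cong reduce (sym (++-identityʳ t))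

  to : R w t ≈ t → palWord w ≈ []
  to fixed = ++-cancelˡ t (palWord w) [] (begin
    reduce (t ++ palWord w)  ≡⟨ R-twisted t tw w ⟨
    reduce (R w t)           ≡⟨ fixed ⟩
    reduce t                 ≡⟨ t≈t++[] ⟩
    reduce (t ++ [])         ∎)

  from : palWord w ≈ [] → R w t ≈ t
  from trivial = begin
    reduce (R w t)           ≡⟨ R-twisted t tw w ⟩
    reduce (t ++ palWord w)  ≡⟨ ++-cong t t (palWord w) [] refl trivial ⟩
    reduce (t ++ [])         ≡⟨ t≈t++[] ⟨
    reduce t                 ∎

Pal-trivial⇔fixes-ab : ∀ w → (Pal w ≈ one) ⇔ (R w ab ≈ ab)
Pal-trivial⇔fixes-ab w = mk⇔
  (++-cancelˡ (b⁻ ∷ a⁻ ∷ []) (R w ab) ab)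
  (++-cong (b⁻ ∷ a⁻ ∷ []) (b⁻ ∷ a⁻ ∷ []) (R w ab) ab refl)

stabiliser-++ : ∀ t u v → R u t ≈ t → R v t ≈ t → R (u ++ v) t ≈ t
stabiliser-++ t u v fu fv = begin
  reduce (R (u ++ v) t)  ≡⟨ cong reduce (R-++ u v t) ⟩
  reduce (R u (R v t))   ≡⟨ R-cong u (R v t) t fv ⟩
  reduce (R u t)         ≡⟨ fu ⟩
  reduce t               ∎
  where open ≡-Reasoning

stabiliser-invW : ∀ t u → R u t ≈ t → R (invW u) t ≈ t
stabiliser-invW t u fu = begin
  reduce (R (invW u) t)        ≡⟨ R-cong (invW u) t (R u t) (sym fu) ⟩
  reduce (R (invW u) (R u t))  ≡⟨ R-invW u t ⟩
  reduce t                     ∎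
  where open ≡-Reasoning

corollary3p2 :
    ((w : Word) → ((Pal w ≈ one) ⇔ (R w ab ≈ ab)) × ((R w ab ≈ ab) ⇔ (R w ba ≈ ba)))
    × ((Pal one ≈ one)
       × ((u v : Word) → Pal u ≈ one → Pal v ≈ one → Pal (u ++ v) ≈ one)
       × ((u : Word) → Pal u ≈ one → Pal (invW u) ≈ one))
corollary3p2 = (λ w → Pal-trivial⇔fixes-ab w , ab⇔ba w) , refl , Pal-++ , Pal-invW
  where
  open Equivalence

  ab⇔ba : ∀ w → (R w ab ≈ ab) ⇔ (R w ba ≈ ba)
  ab⇔ba w = ⇔-trans (fixes-twisted⇔palWord-trivial ab ab-twisted w)
                    (⇔-sym (fixes-twisted⇔palWord-trivial ba ba-twisted w))

  Pal-++ : ∀ u v → Pal u ≈ one → Pal v ≈ one → Pal (u ++ v) ≈ one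
  Pal-++ u v pu pv = from (Pal-trivial⇔fixes-ab (u ++ v))
    (stabiliser-++ ab u v (to (Pal-trivial⇔fixes-ab u) pu) (to (Pal-trivial⇔fixes-ab v) pv))

  Pal-invW : ∀ u → Pal u ≈ one → Pal (invW u) ≈ one
  Pal-invW u pu = from (Pal-trivial⇔fixes-ab (invW u))
    (stabiliser-invW ab u (to (Pal-trivial⇔fixes-ab u) pu))
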